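{- Let $X\in[\omega]^\omega$. Then there exists an antichain $\mathcal{A}\subseteq\mathbb{S}$ such that for every $T\in\mathbb{S}$ which weakly obeys $X$ we have $|\{S\in\mathcal{A}: T\leq S\}|=\mathfrak{c}$.
   Context: The Sacks forcing $\mathbb{S}$ consists of all perfect trees $T\subseteq 2^{<\omega}$, ordered by reverse inclusion; $T\leq S$ means $S\subseteq T$ ($S$ is stronger). A node $t\in T$ ramifies in $T$ if $t^\frown 0,t^\frown 1\in T$. For $s\in T\cap 2^n$ and $n<k$, $s$ ramifies in $T$ below $k$ if there is $t\in T$ of length less than $k-1$ with $s\subseteq t$ and $t$ ramifying in $T$. For $X\in[\omega]^\omega$ (infinite subsets of $\omega$), $\mu_X$ is the increasing enumeration of $X$. A tree $T\in\mathbb{S}$ weakly obeys $X$ if for infinitely many $i\in\omega$, for all $j<2^i$ and all $t\in T\cap 2^{\mu_X(2^i+j)}$, $t$ ramifies in $T$ below $\mu_X(2^i+j+1)$. $\mathfrak{c}$ is the cardinality of the continuum. -}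

module Defs where

open import Data.Bool using (Bool; true; false)
open import Data.List using (List; []; _∷_; _++_; length; [_])
open import Data.Nat using (ℕ; _+_; _^_; _<_; _≤_; _∸_)
open import Data.Product using (Σ; _×_; _,_; ∃; ∃-syntax)
open import Relation.Binary.PropositionalEquality using (_≡_)
open import Relation.Nullary using (¬_)

-- Finite binary strings (elements of 2^{<ω}); Bool stands for {0,1}
-- with false = 0 and true = 1.
Str : Set
Str = List Bool

_⊑_ : Str → Str → Set
s ⊑ t = ∃[ u ] (s ++ u ≡ t)

Sub : Set
Sub = Str → Bool

_∈_ : Str → Sub → Set
t ∈ T = T t ≡ true

_⊆_ : Sub → Sub → Set
S ⊆ T = ∀ t → t ∈ S → t ∈ T

_≐_ : Sub → Sub → Set
S ≐ T = ∀ t → S t ≡ T t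

IsTree : Sub → Set
IsTree T = ([] ∈ T) × (∀ s u → (s ++ u) ∈ T → s ∈ T)

Ramifies : Sub → Str → Set
Ramifies T t = ((t ++ [ false ]) ∈ T) × ((t ++ [ true ]) ∈ T)

IsPerfect : Sub → Set
IsPerfect T = ∀ s → s ∈ T → ∃[ t ] ((s ⊑ t) × (t ∈ T) × Ramifies T t)

Sacks : Set
Sacks = Σ Sub (λ T → IsTree T × IsPerfect T)

tr : Sacks → Sub
tr (T , _) = T

_≤S_ : Sacks → Sacks → Set
T ≤S S = tr S ⊆ tr T

Compatible : Sacks → Sacks → Set
Compatible S S' = ∃[ R ] ((S ≤S R) × (S' ≤S R))

-- An antichain: a set of conditions (given as a predicate on 𝕊, with
-- conditions identified up to extensional equality of trees) whose
-- distinct members are pairwise incompatible.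
IsAntichain : (Sacks → Set) → Set
IsAntichain A = ∀ S S' → A S → A S' → ¬ (tr S ≐ tr S') → ¬ Compatible S S'

-- Infinite subsets X of ω are represented by their increasing enumeration μ_X.
StrictlyIncreasing : (ℕ → ℕ) → Set
StrictlyIncreasing μ = ∀ m n → m < n → μ m < μ n

RamifiesBelow : Sub → Str → ℕ → Set
RamifiesBelow T s k = ∃[ t ] ((t ∈ T) × (s ⊑ t) × (length t < k ∸ 1) × Ramifies T t)

WeaklyObeys : Sacks → (ℕ → ℕ) → Set
WeaklyObeys T μ =
  ∀ N → ∃[ i ] ((N ≤ i) ×
    (∀ j → j < 2 ^ i → ∀ t → t ∈ tr T → length t ≡ μ (2 ^ i + j) →
       RamifiesBelow (tr T) t (μ (2 ^ i + j + 1))))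

-- |{S ∈ A : T ≤ S}| = 𝔠 : 2^ω injects into this set (conditions identified
-- up to extensional equality).  The reverse inequality ≤ 𝔠 holds for every
-- subset of 𝕊, since 𝕊 ⊆ P(2^{<ω}) and 2^{<ω} is countable.
ContinuumManyAbove : (Sacks → Set) → Sacks → Set
ContinuumManyAbove A T =
  Σ ((ℕ → Bool) → Sacks) λ f →
    (∀ x → A (f x) × (T ≤S f x)) ×
    (∀ x y → tr (f x) ≐ tr (f y) → ∀ n → x n ≡ y n)

{-# OPTIONS --safe #-}
-- For a branch y ∈ 2^ω, prune T so that it branches only at levels in the windows
-- [μ a, μ (a + 1)) whose index a = 2^i + j codes a prefix y↾i, keeping the leftmost child
-- elsewhere.  If T weakly obeys μ, every node extends to a level μ (2^i + j) with i large
-- and y↾i coded by 2^i + j; it then ramifies in T inside that window, so the pruned tree is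
-- perfect.  A common extension of two pruned trees ramifies at arbitrarily high levels, each
-- lying in a window of both branches; windows are disjoint and high windows code long
-- prefixes, so the branches coincide.  Letting y interleave an arbitrary x with a code of T
-- then gives an antichain with a distinct member below T for each x.
module Submission where

open import Defs
open import Data.Nat using (ℕ)
open import Data.Product using (Σ; _×_)

open import Level using (0ℓ)
open import Function using (_∘_; _⇔_; mk⇔)
open import Data.Bool using (Bool; true; false; _∧_; _∨_; not)
open import Data.Bool.Properties using (∧-assoc; ∧-conicalˡ; ∧-conicalʳ; ∨-zeroʳ)
  renaming (_≟_ to _≟ᵇ_)
open import Data.Nat using (zero; suc; _+_; _*_; _^_; _≤_; _<_; _∸_; z≤n; s≤s; s≤s⁻¹)
open import Data.Nat.Properties
open import Data.List using (List; []; _∷_; _++_; _∷ʳ_; length; [_]; applyUpTo)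
open import Data.List.Properties
  using (++-assoc; ++-identityʳ; length-++; length-applyUpTo; ∷-injective)
open import Data.Product using (_,_; proj₁; proj₂; ∃-syntax)
open import Data.Sum using (inj₁; inj₂)
open import Relation.Binary.PropositionalEquality
  using (_≡_; refl; sym; trans; cong; cong₂; subst; subst₂; _≗_; module ≡-Reasoning)
open import Relation.Nullary using (Dec; yes; no; does; _×-dec_)
import Relation.Nullary.Decidable as Dec
open import Relation.Unary using (Pred; Decidable)

private
  variable
    b : Bool
    a a′ m n ℓ : ℕ
    y y′ : ℕ → Bool
    r s t : Str

⊑-trans : r ⊑ s → s ⊑ t → r ⊑ t
⊑-trans {r} (u , refl) (v , refl) = u ++ v , sym (++-assoc r u v)

⊑-length : s ⊑ t → length s ≤ length t
⊑-length {s} (u , refl) = ≤-trans (m≤m+n _ _) (≤-reflexive (sym (length-++ s)))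

length-∷ʳ : ∀ {A : Set} (xs : List A) x → length (xs ∷ʳ x) ≡ suc (length xs)
length-∷ʳ xs x = trans (length-++ xs) (+-comm (length xs) 1)

-- rank enumerates 2^{<ω} in bijective base 2, least significant digit first.
rank : Str → ℕ
rank [] = 0
rank (false ∷ s) = 1 + 2 * rank s
rank (true ∷ s) = 2 + 2 * rank s

increment : Str → Str
increment [] = [ false ]
increment (false ∷ s) = true ∷ s
increment (true ∷ s) = false ∷ increment s

unrank : ℕ → Str
unrank zero = []
unrank (suc n) = increment (unrank n)

unrank-odd : ∀ m → unrank (1 + 2 * m) ≡ false ∷ unrank m
unrank-even : ∀ m → unrank (2 + 2 * m) ≡ true ∷ unrank m
unrank-odd zero = refl
unrank-odd (suc m) = trans (cong (unrank ∘ suc) (*-suc 2 m)) (cong increment (unrank-even m))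
unrank-even m = cong increment (unrank-odd m)

unrank-rank : ∀ s → unrank (rank s) ≡ s
unrank-rank [] = refl
unrank-rank (false ∷ s) = trans (unrank-odd (rank s)) (cong (false ∷_) (unrank-rank s))
unrank-rank (true ∷ s) = trans (unrank-even (rank s)) (cong (true ∷_) (unrank-rank s))

rank-injective : rank s ≡ rank t → s ≡ t
rank-injective {s} {t} eq = trans (sym (unrank-rank s)) (trans (cong unrank eq) (unrank-rank t))

length≤rank : ∀ s → length s ≤ rank s
length≤rank [] = z≤n
length≤rank (false ∷ s) = s≤s (≤-trans (length≤rank s) (m≤m+n _ _))
length≤rank (true ∷ s) = s≤s (≤-trans (length≤rank s) (≤-trans (m≤m+n _ _) (n≤1+n _)))

2^length≤suc-rank : ∀ s → 2 ^ length s ≤ suc (rank s)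
2^length≤suc-rank [] = ≤-refl
2^length≤suc-rank (false ∷ s) =
  ≤-trans (*-monoʳ-≤ 2 (2^length≤suc-rank s)) (≤-reflexive (*-suc 2 (rank s)))
2^length≤suc-rank (true ∷ s) =
  ≤-trans (*-monoʳ-≤ 2 (2^length≤suc-rank s)) (≤-trans (≤-reflexive (*-suc 2 (rank s))) (n≤1+n _))

suc-rank<2^suc-length : ∀ s → suc (rank s) < 2 ^ suc (length s)
suc-rank<2^suc-length [] = ≤-refl
suc-rank<2^suc-length (b ∷ s) = begin
  2 + rank (b ∷ s)        ≤⟨ +-monoʳ-≤ 2 (rank-∷ b) ⟩
  2 * 2 + 2 * rank s      ≡⟨ *-distribˡ-+ 2 2 (rank s) ⟨
  2 * (2 + rank s)        ≤⟨ *-monoʳ-≤ 2 (suc-rank<2^suc-length s) ⟩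
  2 * 2 ^ suc (length s)  ∎
  where
  open ≤-Reasoning
  rank-∷ : ∀ b → rank (b ∷ s) ≤ 2 + 2 * rank s
  rank-∷ false = n≤1+n _
  rank-∷ true = ≤-refl

interleave : (ℕ → Bool) → (ℕ → Bool) → ℕ → Bool
interleave x z zero = x 0
interleave x z (suc zero) = z 0
interleave x z (suc (suc n)) = interleave (x ∘ suc) (z ∘ suc) n

interleave-even : ∀ x z n → interleave x z (2 * n) ≡ x n
interleave-even x z zero = refl
interleave-even x z (suc n) =
  trans (cong (interleave x z) (*-suc 2 n)) (interleave-even (x ∘ suc) (z ∘ suc) n)

interleave-odd : ∀ x z n → interleave x z (1 + 2 * n) ≡ z n
interleave-odd x z zero = refl
interleave-odd x z (suc n) =
  trans (cong (interleave x z ∘ suc) (*-suc 2 n)) (interleave-odd (x ∘ suc) (z ∘ suc) n)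

interleave-injective : ∀ {x x′ z z′ : ℕ → Bool} →
  interleave x z ≗ interleave x′ z′ → x ≗ x′ × z ≗ z′
interleave-injective {x} {x′} {z} {z′} same =
  (λ n → trans (sym (interleave-even x z n)) (trans (same (2 * n)) (interleave-even x′ z′ n))) ,
  (λ n → trans (sym (interleave-odd x z n)) (trans (same (1 + 2 * n)) (interleave-odd x′ z′ n)))

∘-unrank-cancel : ∀ {S S′ : Sub} → S ∘ unrank ≗ S′ ∘ unrank → S ≐ S′
∘-unrank-cancel {S} {S′} same t = subst (λ u → S u ≡ S′ u) (unrank-rank t) (same (rank t))

applyUpTo-cong : ∀ {A : Set} {f g : ℕ → A} → f ≗ g → ∀ n → applyUpTo f n ≡ applyUpTo g n
applyUpTo-cong f≗g zero = refl
applyUpTo-cong f≗g (suc n) = cong₂ _∷_ (f≗g 0) (applyUpTo-cong (f≗g ∘ suc) n)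

applyUpTo-agree : ∀ {A : Set} (f g : ℕ → A) {i j n} →
  applyUpTo f i ≡ applyUpTo g j → n < i → f n ≡ g n
applyUpTo-agree f g {suc i} {suc j} {zero} eq _ = proj₁ (∷-injective eq)
applyUpTo-agree f g {suc i} {suc j} {suc n} eq (s≤s n<i) =
  applyUpTo-agree (f ∘ suc) (g ∘ suc) (proj₂ (∷-injective eq)) n<i

leftmostChild : Sub → Str → Bool
leftmostChild T p = not (T (p ∷ʳ false))

module _ {T : Sub} where

  leftmostChild-∈ : (s ∷ʳ b) ∈ T → (s ∷ʳ leftmostChild T s) ∈ T
  leftmostChild-∈ {s} {false} s0∈ rewrite s0∈ = s0∈
  leftmostChild-∈ {s} {true} s1∈ with T (s ∷ʳ false) in s0
  ... | true = s0
  ... | false = s1∈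

  some-child : IsTree T → IsPerfect T → s ∈ T → ∃[ b ] ((s ∷ʳ b) ∈ T)
  some-child {s} (_ , closed) perfect s∈ with perfect s s∈
  ... | _ , ([] , refl) , _ , (t0 , _) = false , subst (λ q → (q ∷ʳ false) ∈ T) (++-identityʳ s) t0
  ... | _ , (b ∷ u , refl) , t∈ , _ =
    b , closed (s ∷ʳ b) u (subst (_∈ T) (sym (++-assoc s [ b ] u)) t∈)

⊆-≐-trans : ∀ {R S S′ : Sub} → R ⊆ S → S ≐ S′ → R ⊆ S′
⊆-≐-trans R⊆S S≐S′ t t∈ = trans (sym (S≐S′ t)) (R⊆S t t∈)

ramifying-node-above : (R : Sacks) → ∀ k → ∃[ t ] (t ∈ tr R × Ramifies (tr R) t × k ≤ length t)
ramifying-node-above (_ , (root , _) , perfect) zero with perfect [] root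
... | t , _ , t∈ , ramifies = t , t∈ , ramifies , z≤n
ramifying-node-above R@(_ , _ , perfect) (suc k) with ramifying-node-above R k
... | t , _ , (t0 , _) , k≤t with perfect (t ∷ʳ false) t0
... | t′ , t0⊑t′ , t′∈ , ramifies = t′ , t′∈ , ramifies ,
  ≤-trans (s≤s k≤t) (subst (_≤ length t′) (length-∷ʳ t false) (⊑-length t0⊑t′))

RamifyingWindowsIn : Sub → Pred ℕ 0ℓ → Set
RamifyingWindowsIn T L = ∀ N → ∃[ a ] ∃[ c ] (N ≤ a × (∀ ℓ → a ≤ ℓ → ℓ < c → L ℓ) ×
  (∀ t → t ∈ T → length t ≡ a → RamifiesBelow T t c))

-- pruned T L? may branch only at levels in L; elsewhere a node keeps just its leftmost child in T.
module _ (T : Sub) {L : Pred ℕ 0ℓ} (L? : Decidable L) where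

  allowed : Str → Bool → Bool
  allowed p b = does (L? (length p)) ∨ does (b ≟ᵇ leftmostChild T p)

  followsFrom : Str → Str → Bool
  followsFrom p [] = true
  followsFrom p (b ∷ r) = allowed p b ∧ followsFrom (p ∷ʳ b) r

  pruned : Sub
  pruned t = T t ∧ followsFrom [] t

module _ {T : Sub} {L : Pred ℕ 0ℓ} {L? : Decidable L} where

  followsFrom-++ : ∀ p r u →
    followsFrom T L? p (r ++ u) ≡ followsFrom T L? p r ∧ followsFrom T L? (p ++ r) u
  followsFrom-++ p [] u = cong (λ q → followsFrom T L? q u) (sym (++-identityʳ p))
  followsFrom-++ p (b ∷ r) u = begin
    allowed T L? p b ∧ followsFrom T L? (p ∷ʳ b) (r ++ u)
      ≡⟨ cong (allowed T L? p b ∧_) (followsFrom-++ (p ∷ʳ b) r u) ⟩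
    allowed T L? p b ∧ (followsFrom T L? (p ∷ʳ b) r ∧ followsFrom T L? (p ∷ʳ b ++ r) u)
      ≡⟨ ∧-assoc (allowed T L? p b) _ _ ⟨
    (allowed T L? p b ∧ followsFrom T L? (p ∷ʳ b) r) ∧ followsFrom T L? (p ∷ʳ b ++ r) u
      ≡⟨ cong (λ q → (allowed T L? p b ∧ followsFrom T L? (p ∷ʳ b) r) ∧ followsFrom T L? q u)
           (++-assoc p [ b ] r) ⟩
    (allowed T L? p b ∧ followsFrom T L? (p ∷ʳ b) r) ∧ followsFrom T L? (p ++ b ∷ r) u ∎
    where open ≡-Reasoning

  pruned⊆ : pruned T L? ⊆ T
  pruned⊆ t = ∧-conicalˡ (T t) _

  followsFrom-of-∈ : t ∈ pruned T L? → followsFrom T L? [] t ≡ true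
  followsFrom-of-∈ {t} = ∧-conicalʳ (T t) _

  pruned-isTree : IsTree T → IsTree (pruned T L?)
  pruned-isTree (root , closed) = cong₂ _∧_ root refl , prefix-closed
    where
    prefix-closed : ∀ s u → (s ++ u) ∈ pruned T L? → s ∈ pruned T L?
    prefix-closed s u su∈ = cong₂ _∧_ (closed s u (pruned⊆ _ su∈))
      (∧-conicalˡ (followsFrom T L? [] s) _
        (trans (sym (followsFrom-++ [] s u)) (followsFrom-of-∈ su∈)))

  allowed-if-level : ∀ p → L (length p) → allowed T L? p b ≡ true
  allowed-if-level p l = cong (_∨ _) (Dec.dec-true (L? _) l)

  allowed-leftmost : ∀ p → allowed T L? p (leftmostChild T p) ≡ true
  allowed-leftmost p =
    trans (cong (does (L? _) ∨_) (Dec.dec-true (leftmostChild T p ≟ᵇ _) refl)) (∨-zeroʳ _)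

  allowed-of-∷ʳ : (t ∷ʳ b) ∈ pruned T L? → allowed T L? t b ≡ true
  allowed-of-∷ʳ {t} {b} tb∈ =
    ∧-conicalˡ (allowed T L? t b) true (∧-conicalʳ (followsFrom T L? [] t) _
      (trans (sym (followsFrom-++ [] t [ b ])) (followsFrom-of-∈ tb∈)))

  pruned-∷ʳ : t ∈ pruned T L? → (t ∷ʳ b) ∈ T → allowed T L? t b ≡ true → (t ∷ʳ b) ∈ pruned T L?
  pruned-∷ʳ {t} {b} t∈ tb∈ ok = cong₂ _∧_ tb∈
    (trans (followsFrom-++ [] t [ b ]) (cong₂ _∧_ (followsFrom-of-∈ t∈) (cong₂ _∧_ ok refl)))

  ramifies⇒level : Ramifies (pruned T L?) t → L (length t)
  ramifies⇒level {t} (t0 , t1) =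
    both-allowed (L? (length t)) (leftmostChild T t) (allowed-of-∷ʳ t0) (allowed-of-∷ʳ t1)
    where
    both-allowed : ∀ {A : Set} (a? : Dec A) d →
      does a? ∨ does (false ≟ᵇ d) ≡ true → does a? ∨ does (true ≟ᵇ d) ≡ true → A
    both-allowed (yes a) _ _ _ = a
    both-allowed (no _) false _ ()
    both-allowed (no _) true () _

  followsFrom-window : ∀ p u → (∀ ℓ → length p ≤ ℓ → ℓ < length (p ++ u) → L ℓ) →
    followsFrom T L? p u ≡ true
  followsFrom-window p [] _ = refl
  followsFrom-window p (b ∷ u) window =
    cong₂ _∧_ (allowed-if-level {b = b} p (window _ ≤-refl p<))
              (followsFrom-window (p ∷ʳ b) u window′)
    where
    p< : length p < length (p ++ b ∷ u)
    p< = subst (_≤ length (p ++ b ∷ u)) (length-∷ʳ p b)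
           (⊑-length {p ∷ʳ b} (u , ++-assoc p [ b ] u))
    window′ : ∀ ℓ → length (p ∷ʳ b) ≤ ℓ → ℓ < length (p ∷ʳ b ++ u) → L ℓ
    window′ ℓ lo hi = window ℓ (≤-trans (n≤1+n _) (subst (_≤ ℓ) (length-∷ʳ p b) lo))
      (subst (λ q → ℓ < length q) (++-assoc p [ b ] u) hi)

  pruned-window : s ∈ pruned T L? → s ⊑ t → t ∈ T →
    (∀ ℓ → length s ≤ ℓ → ℓ < length t → L ℓ) → t ∈ pruned T L?
  pruned-window {s} s∈ (u , refl) t∈ window = cong₂ _∧_ t∈
    (trans (followsFrom-++ [] s u)
      (cong₂ _∧_ (followsFrom-of-∈ s∈) (followsFrom-window s u window)))

  module _ (tree : IsTree T) (perfect : IsPerfect T) where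

    pruned-grow : s ∈ pruned T L? → (s ∷ʳ leftmostChild T s) ∈ pruned T L?
    pruned-grow {s} s∈ =
      pruned-∷ʳ s∈ (leftmostChild-∈ {T = T} (proj₂ (some-child tree perfect (pruned⊆ s s∈))))
        (allowed-leftmost s)

    pruned-extend : s ∈ pruned T L? → ∀ k →
      ∃[ s′ ] (s ⊑ s′ × length s′ ≡ length s + k × s′ ∈ pruned T L?)
    pruned-extend {s} s∈ zero = s , ([] , ++-identityʳ s) , sym (+-identityʳ _) , s∈
    pruned-extend {s} s∈ (suc k) with pruned-extend (pruned-grow s∈) k
    ... | s′ , s⊑s′ , length-s′ , s′∈ = s′ , ⊑-trans (_ , refl) s⊑s′ ,
      trans length-s′ (trans (cong (_+ k) (length-∷ʳ s _)) (sym (+-suc _ k))) , s′∈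

    pruned-perfect : RamifyingWindowsIn T L → IsPerfect (pruned T L?)
    pruned-perfect windows s s∈ with windows (length s)
    ... | a , c , s≤a , window , ramify with pruned-extend s∈ (a ∸ length s)
    ... | s′ , s⊑s′ , length-s′ , s′∈ with trans length-s′ (m+[n∸m]≡n s≤a)
    ... | |s′|≡a with ramify s′ (pruned⊆ s′ s′∈) |s′|≡a
    ... | t , _ , s′⊑t , t<c∸1 , (t0 , t1) =
      t , ⊑-trans s⊑s′ s′⊑t , proj₂ (pruned-isTree tree) t [ false ] (child t0) ,
      child t0 , child t1
      where
      child : (t ∷ʳ b) ∈ T → (t ∷ʳ b) ∈ pruned T L?
      child {b} tb∈ = pruned-window s′∈ (⊑-trans s′⊑t (_ , refl)) tb∈ λ ℓ lo hi →
        window ℓ (subst (_≤ ℓ) |s′|≡a lo)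
          (≤-<-trans (s≤s⁻¹ (subst (ℓ <_) (length-∷ʳ t b) hi)) (<-≤-trans t<c∸1 (m∸n≤m c 1)))

module _ {T T′ : Sub} {L L′ : Pred ℕ 0ℓ} {L? : Decidable L} {L′? : Decidable L′} where

  pruned-cong : T ≐ T′ → (∀ ℓ → L ℓ ⇔ L′ ℓ) → pruned T L? ≐ pruned T′ L′?
  pruned-cong T≐T′ L⇔L′ t = cong₂ _∧_ (T≐T′ t) (followsFrom-cong [] t)
    where
    followsFrom-cong : ∀ p r → followsFrom T L? p r ≡ followsFrom T′ L′? p r
    followsFrom-cong p [] = refl
    followsFrom-cong p (b ∷ r) = cong₂ _∧_
      (cong₂ _∨_ (Dec.does-⇔ (L⇔L′ _) (L? _) (L′? _))
                 (cong (λ d → does (b ≟ᵇ not d)) (T≐T′ (p ∷ʳ false))))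
      (followsFrom-cong (p ∷ʳ b) r)

  common-ramification-level : (R : Sacks) → tr R ⊆ pruned T L? → tr R ⊆ pruned T′ L′? →
    ∀ k → ∃[ ℓ ] (k ≤ ℓ × L ℓ × L′ ℓ)
  common-ramification-level R R⊆ R⊆′ k with ramifying-node-above R k
  ... | t , _ , (t0 , t1) , k≤t =
    length t , k≤t , ramifies⇒level {T = T} {L? = L?} (R⊆ _ t0 , R⊆ _ t1) ,
                     ramifies⇒level {T = T′} {L? = L′?} (R⊆′ _ t0 , R⊆′ _ t1)

module Windows (μ : ℕ → ℕ) (μ-strict : StrictlyIncreasing μ) where

  μ-mono-≤ : m ≤ n → μ m ≤ μ n
  μ-mono-≤ {m} {n} m≤n with m≤n⇒m<n∨m≡n m≤n
  ... | inj₁ m<n = <⇒≤ (μ-strict m n m<n)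
  ... | inj₂ refl = ≤-refl

  μ-cancel-< : μ m < μ n → m < n
  μ-cancel-< μm<μn = ≰⇒> (λ n≤m → <⇒≱ μm<μn (μ-mono-≤ n≤m))

  n≤μn : ∀ n → n ≤ μ n
  n≤μn zero = z≤n
  n≤μn (suc n) = ≤-trans (s≤s (n≤μn n)) (μ-strict n (suc n) ≤-refl)

  Window : ℕ → ℕ → Set
  Window a ℓ = μ a ≤ ℓ × ℓ < μ (suc a)

  window? : ∀ a ℓ → Dec (Window a ℓ)
  window? a ℓ = μ a ≤? ℓ ×-dec ℓ <? μ (suc a)

  window-unique : Window a ℓ → Window a′ ℓ → a ≡ a′
  window-unique (lo , hi) (lo′ , hi′) =
    ≤-antisym (s≤s⁻¹ (μ-cancel-< (≤-<-trans lo hi′))) (s≤s⁻¹ (μ-cancel-< (≤-<-trans lo′ hi)))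

  -- index y i is the paper's 2^i + j, with j < 2^i read off the first i digits of y.
  index : (ℕ → Bool) → ℕ → ℕ
  index y i = suc (rank (applyUpTo y i))

  i<index : ∀ y i → i < index y i
  i<index y i =
    s≤s (subst (_≤ rank (applyUpTo y i)) (length-applyUpTo y i) (length≤rank (applyUpTo y i)))

  2^i≤index : ∀ y i → 2 ^ i ≤ index y i
  2^i≤index y i =
    subst (λ k → 2 ^ k ≤ index y i) (length-applyUpTo y i) (2^length≤suc-rank (applyUpTo y i))

  index<2^suc-i : ∀ y i → index y i < 2 ^ suc i
  index<2^suc-i y i = subst (λ k → index y i < 2 ^ suc k) (length-applyUpTo y i)
    (suc-rank<2^suc-length (applyUpTo y i))

  Active : (ℕ → Bool) → Pred ℕ 0ℓ
  Active y ℓ = ∃[ i ] Window (index y i) ℓ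

  active? : ∀ y → Decidable (Active y)
  active? y ℓ = Dec.map (mk⇔ unbound bound) (anyUpTo? (λ i → window? (index y i) ℓ) (suc ℓ))
    where
    unbound : ∃[ i ] (i < suc ℓ × Window (index y i) ℓ) → Active y ℓ
    unbound (i , _ , w) = i , w
    bound : Active y ℓ → ∃[ i ] (i < suc ℓ × Window (index y i) ℓ)
    bound (i , w) = i , s≤s (≤-trans (<⇒≤ (i<index y i)) (≤-trans (n≤μn _) (proj₁ w))) , w

  active-cong : y ≗ y′ → ∀ ℓ → Active y ℓ ⇔ Active y′ ℓ
  active-cong y≗y′ ℓ = mk⇔ (transport y≗y′) (transport (sym ∘ y≗y′))
    where
    transport : y ≗ y′ → Active y ℓ → Active y′ ℓ
    transport y≗y′ (i , w) = i , subst (λ σ → Window (suc (rank σ)) ℓ) (applyUpTo-cong y≗y′ i) w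

  active-agree : Active y ℓ → Active y′ ℓ → μ (2 ^ suc n) ≤ ℓ → y n ≡ y′ n
  active-agree {y} {ℓ} {y′} {n} (i , w) (i′ , w′) deep =
    applyUpTo-agree y y′ {i} {i′} (rank-injective (suc-injective (window-unique w w′))) n<i
    where
    2^suc-n<2^suc-i : 2 ^ suc n < 2 ^ suc i
    2^suc-n<2^suc-i =
      ≤-<-trans (s≤s⁻¹ (μ-cancel-< (≤-<-trans deep (proj₂ w)))) (index<2^suc-i y i)
    n<i : n < i
    n<i = s≤s⁻¹ (≰⇒> (λ i≤n → <⇒≱ 2^suc-n<2^suc-i (^-monoʳ-≤ 2 i≤n)))

  obeys⇒ramifyingWindows : ∀ T → WeaklyObeys T μ → ∀ y → RamifyingWindowsIn (tr T) (Active y)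
  obeys⇒ramifyingWindows T obeys y N with obeys N
  ... | i , N≤i , ramify = μ k , μ (suc k) , N≤μk , (λ ℓ lo hi → i , lo , hi) , ramify-in-window
    where
    k : ℕ
    k = index y i
    j : ℕ
    j = k ∸ 2 ^ i
    2^i+j≡k : 2 ^ i + j ≡ k
    2^i+j≡k = m+[n∸m]≡n (2^i≤index y i)
    j<2^i : j < 2 ^ i
    j<2^i = +-cancelˡ-< (2 ^ i) j (2 ^ i) (subst₂ _<_ (sym 2^i+j≡k)
      (cong (2 ^ i +_) (+-identityʳ (2 ^ i))) (index<2^suc-i y i))
    N≤μk : N ≤ μ k
    N≤μk = ≤-trans N≤i (≤-trans (<⇒≤ (i<index y i)) (n≤μn k))
    ramify-in-window : ∀ t → t ∈ tr T → length t ≡ μ k → RamifiesBelow (tr T) t (μ (suc k))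
    ramify-in-window t t∈ |t|≡μk =
      subst (RamifiesBelow (tr T) t ∘ μ) (trans (+-comm _ 1) (cong suc 2^i+j≡k))
        (ramify j j<2^i t t∈ (trans |t|≡μk (cong μ (sym 2^i+j≡k))))

  pruned-separates : ∀ {T T′ : Sub} (R : Sacks) →
    tr R ⊆ pruned T (active? y) → tr R ⊆ pruned T′ (active? y′) → y ≗ y′
  pruned-separates R R⊆ R⊆′ n with common-ramification-level R R⊆ R⊆′ (μ (2 ^ suc n))
  ... | ℓ , deep , active , active′ = active-agree active active′ deep

lemma2p4 : (μ : ℕ → ℕ) → StrictlyIncreasing μ →
    Σ (Sacks → Set) λ A → IsAntichain A ×
      (∀ T → WeaklyObeys T μ → ContinuumManyAbove A T)
lemma2p4 μ μ-strict = A , A-antichain , A-continuum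
  where
  open Windows μ μ-strict

  -- The branch also codes T, so compatible members share their tree as well as their x.
  label : Sacks → (ℕ → Bool) → ℕ → Bool
  label T x = interleave x (tr T ∘ unrank)

  member : Sacks → (ℕ → Bool) → Sub
  member T x = pruned (tr T) (active? (label T x))

  A : Sacks → Set
  A S = ∃[ T ] ∃[ x ] (tr S ≐ member T x)

  A-antichain : IsAntichain A
  A-antichain S S′ (T , x , S≐) (T′ , x′ , S′≐) S≉S′ (R , R⊆S , R⊆S′) =
    S≉S′ λ t → trans (S≐ t) (trans (same-member t) (sym (S′≐ t)))
    where
    same : label T x ≗ label T′ x′
    same = pruned-separates R (⊆-≐-trans R⊆S S≐) (⊆-≐-trans R⊆S′ S′≐)
    same-member : member T x ≐ member T′ x′
    same-member =
      pruned-cong (∘-unrank-cancel (proj₂ (interleave-injective same))) (active-cong same)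

  A-continuum : ∀ T → WeaklyObeys T μ → ContinuumManyAbove A T
  A-continuum T@(_ , tree , perfect) obeys =
    f , (λ x → (T , x , λ _ → refl) , pruned⊆) , f-injective
    where
    f : (ℕ → Bool) → Sacks
    f x = member T x , pruned-isTree tree ,
          pruned-perfect tree perfect (obeys⇒ramifyingWindows T obeys (label T x))
    f-injective : ∀ x x′ → tr (f x) ≐ tr (f x′) → x ≗ x′
    f-injective x x′ fx≐fx′ =
      proj₁ (interleave-injective
        (pruned-separates (f x) (λ _ t∈ → t∈) (⊆-≐-trans (λ _ t∈ → t∈) fx≐fx′)))
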